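{- Let $n\ge4$ and let $\Delta_n$ be a uniform flag complex on the vertex set $V_n$ representing a triangulation of $\partial P_n$. Assume that pairs of arrows of types $THTH$ and $HTHT$ nest in $\Delta_n$. Then pairs of arrows of types $HTTH$ and $THHT$ cross in $\Delta_n$.
   Context: $P_n$ is the convex hull of $e_j-e_i$ ($i\ne j$) in $\mathbb{R}^{n+1}$. An arrow $(i,j)$, $i\ne j\in\{1,\dots,n+1\}$, with tail $i$ and head $j$, is identified with $e_j-e_i$; $V_n$ is the set of arrows. A complex on $V_n$ represents a triangulation of $\partial P_n$ if the convex hulls of its faces form a triangulation of $\partial P_n$. A flag complex on $V_n$ is uniform if whether a pair $\{(i_1,j_1),(i_2,j_2)\}$ is an edge depends only on the equalities and inequalities among $i_1,i_2,j_1,j_2$. For two arrows with four distinct endpoints $p_1<\dots<p_4$, the type is the $T/H$ word recording tails/heads at $p_1,\dots,p_4$; the pair nests if it joins $\{p_1,p_4\},\{p_2,p_3\}$, crosses if it joins $\{p_1,p_3\},\{p_2,p_4\}$. "Type $W$ nests" means every nesting pair of type $W$ is an edge; "type $W$ crosses" means every crossing pair of type $W$ is an edge. -}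

module Defs where

open import Data.Nat using (ℕ; zero; suc)
open import Data.Fin using (Fin; zero; suc; _<_; _≟_)
open import Data.Fin.Properties using (<⇒≢)
open import Data.Rational using (ℚ; 0ℚ; 1ℚ; _+_; _*_; _-_; _≤_)
open import Data.List using (List; length; lookup)
open import Data.List.Membership.Propositional using (_∈_)
open import Data.List.Relation.Unary.Unique.Propositional using (Unique)
open import Data.List.Relation.Unary.AllPairs using (AllPairs)
open import Data.Product using (Σ; ∃; _×_; _,_)
open import Data.Bool using (if_then_else_)
open import Relation.Nullary using (¬_; Dec; yes; no)
open import Relation.Nullary.Decidable using (⌊_⌋)
open import Relation.Binary.PropositionalEquality using (_≡_; _≢_; sym)
open import Relation.Binary.Core using (Rel)
open import Function.Bundles using (_⇔_)

-- The points 1,…,n+1 are represented by Fin (suc n)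
-- (point k+1 of the paper is Fin element k; the order is preserved).  The distinctness
-- proof is irrelevant, so two arrows are equal iff tails and heads are.

record Arrow (n : ℕ) : Set where
  constructor arrow
  field
    tail : Fin (suc n)
    head : Fin (suc n)
    .distinct : tail ≢ head

open Arrow public

∑ : ∀ {m : ℕ} → (Fin m → ℚ) → ℚ
∑ {zero}  f = 0ℚ
∑ {suc m} f = f zero + ∑ (λ k → f (suc k))

Point : ℕ → Set
Point n = Fin (suc n) → ℚ

e : ∀ {n} → Fin (suc n) → Point n
e j k = if ⌊ k ≟ j ⌋ then 1ℚ else 0ℚ

-- the arrow (i , j) is identified with e_j − e_i
vec : ∀ {n} → Arrow n → Point n
vec a k = e (head a) k - e (tail a) k

dot : ∀ {n} → Point n → Point n → ℚ
dot c x = ∑ (λ k → c k * x k)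

combo : ∀ {n} (F : List (Arrow n)) → (Fin (length F) → ℚ) → Point n
combo F λc k = ∑ (λ t → λc t * vec (lookup F t) k)

InConv : ∀ {n} → List (Arrow n) → Point n → Set
InConv F x = Σ (Fin (length F) → ℚ) λ λc →
  ((t : Fin (length F)) → 0ℚ ≤ λc t) × (∑ λc ≡ 1ℚ) ×
  ((k : Fin _) → combo F λc k ≡ x k)

AffInd : ∀ {n} → List (Arrow n) → Set
AffInd F = (μ : Fin (length F) → ℚ) → ∑ μ ≡ 0ℚ →
  ((k : Fin _) → combo F μ k ≡ 0ℚ) → (t : Fin (length F)) → μ t ≡ 0ℚ

-- x ∈ P_n = conv { e_j − e_i : i ≠ j }  (conv of a set = union of the
-- convex hulls of its finite subsets)
InP : (n : ℕ) → Point n → Set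
InP n x = ∃ λ (L : List (Arrow n)) → InConv L x

-- x ∈ ∂P_n (relative boundary): x ∈ P_n and x lies on a proper face,
-- i.e. some linear functional c, non-constant on the vertices of P_n,
-- attains its maximum over P_n at x.
InBoundary : (n : ℕ) → Point n → Set
InBoundary n x = InP n x ×
  (Σ (Point n) λ c →
     (Σ (Arrow n) λ a → Σ (Arrow n) λ b → dot c (vec a) ≢ dot c (vec b)) ×
     ((a : Arrow n) → dot c (vec a) ≤ dot c x))

-- Flag complexes on V_n, given by their 1-skeleton (a symmetric
-- relation E on arrows).  Faces are the cliques, represented by
-- duplicate-free lists of arrows.

FlagFace : ∀ {n} → Rel (Arrow n) _ → List (Arrow n) → Set
FlagFace E F = Unique F × AllPairs E F

-- A complex (given by its predicate of faces) represents a triangulation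
-- of ∂P_n: the convex hulls of its faces are simplices, they form a
-- geometric simplicial complex, and their union is ∂P_n.
record RepresentsTriangulation (n : ℕ) (Face : List (Arrow n) → Set) : Set where
  field
    simplices   : ∀ F → Face F → AffInd F
    intersect   : ∀ F G (x : Point n) → Face F → Face G → InConv F x → InConv G x →
                  ∃ λ (H : List (Arrow n)) →
                    ((a : Arrow n) → a ∈ H → (a ∈ F) × (a ∈ G)) × InConv H x
    inBoundary  : ∀ F (x : Point n) → Face F → InConv F x → InBoundary n x
    covers      : ∀ (x : Point n) → InBoundary n x →
                  ∃ λ (F : List (Arrow n)) → Face F × InConv F x

-- Uniformity: whether {a , b} is an edge depends only on the relative
-- order (hence also the equalities) among tail a, head a, tail b, head b.

quad : ∀ {n} → Arrow n → Arrow n → Fin 4 → Fin (suc n)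
quad a b zero                      = tail a
quad a b (suc zero)                = head a
quad a b (suc (suc zero))          = tail b
quad a b (suc (suc (suc zero)))    = head b

SameOrderType : ∀ {n} → Arrow n → Arrow n → Arrow n → Arrow n → Set
SameOrderType a b a' b' = (p q : Fin 4) →
  ((quad a b p < quad a b q) ⇔ (quad a' b' p < quad a' b' q)) ×
  ((quad a b p ≡ quad a b q) ⇔ (quad a' b' p ≡ quad a' b' q))

Uniform : ∀ {n} → Rel (Arrow n) _ → Set
Uniform {n} E = (a b a' b' : Arrow n) → a ≢ b → a' ≢ b' →
  SameOrderType a b a' b' → E a b → E a' b'

-- Nesting / crossing for the four relevant types.
-- For p₁ < p₂ < p₃ < p₄, `p ⇒ q` is the arrow with tail p and head q.

up : ∀ {n} {p q : Fin (suc n)} → p < q → Arrow n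
up {p = p} {q} p<q = arrow p q (<⇒≢ p<q)

down : ∀ {n} {p q : Fin (suc n)} → p < q → Arrow n
down {p = p} {q} p<q = arrow q p (λ eq → <⇒≢ p<q (sym eq))

-- Type THTH (tails p₁,p₃; heads p₂,p₄) nests: {p₁,p₄},{p₂,p₃} joined,
-- i.e. the pair  p₁→p₄ , p₃→p₂  is an edge.
NestsTHTH : ∀ {n} → Rel (Arrow n) _ → Set
NestsTHTH {n} E = {p₁ p₂ p₃ p₄ : Fin (suc n)} →
  (h₁₂ : p₁ < p₂) (h₂₃ : p₂ < p₃) (h₃₄ : p₃ < p₄) (h₁₄ : p₁ < p₄) →
  E (up h₁₄) (down h₂₃)

-- Type HTHT (heads p₁,p₃; tails p₂,p₄) nests: pair  p₄→p₁ , p₂→p₃.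
NestsHTHT : ∀ {n} → Rel (Arrow n) _ → Set
NestsHTHT {n} E = {p₁ p₂ p₃ p₄ : Fin (suc n)} →
  (h₁₂ : p₁ < p₂) (h₂₃ : p₂ < p₃) (h₃₄ : p₃ < p₄) (h₁₄ : p₁ < p₄) →
  E (down h₁₄) (up h₂₃)

-- Type HTTH (heads p₁,p₄; tails p₂,p₃) crosses: {p₁,p₃},{p₂,p₄} joined,
-- i.e. the pair  p₃→p₁ , p₂→p₄  is an edge.
CrossesHTTH : ∀ {n} → Rel (Arrow n) _ → Set
CrossesHTTH {n} E = {p₁ p₂ p₃ p₄ : Fin (suc n)} →
  (h₁₂ : p₁ < p₂) (h₂₃ : p₂ < p₃) (h₃₄ : p₃ < p₄)
  (h₁₃ : p₁ < p₃) (h₂₄ : p₂ < p₄) →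
  E (down h₁₃) (up h₂₄)

-- Type THHT (tails p₁,p₄; heads p₂,p₃) crosses: pair  p₁→p₃ , p₄→p₂.
CrossesTHHT : ∀ {n} → Rel (Arrow n) _ → Set
CrossesTHHT {n} E = {p₁ p₂ p₃ p₄ : Fin (suc n)} →
  (h₁₂ : p₁ < p₂) (h₂₃ : p₂ < p₃) (h₃₄ : p₃ < p₄)
  (h₁₃ : p₁ < p₃) (h₂₄ : p₂ < p₄) →
  E (up h₁₃) (down h₂₄)

Symmetric : ∀ {n} → Rel (Arrow n) _ → Set
Symmetric {n} E = (a b : Arrow n) → E a b → E b a

module Submission where

-- By uniformity it suffices to study the points v₀ < … < v₄.  For heads H and
-- tails T, the functional Σ_H e_h − Σ_T e_t is ≤ 2 on P_n, with equality exactly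
-- on the arrows T → H; a face covering the barycentre of this face of P_n uses
-- only such arrows and touches all of H ∪ T (SignedFace.top-cover).  So the
-- square T = {v₁,v₂}, H = {v₀,v₃} contains its separated or its crossing
-- diagonal.  The separated one is excluded: by uniformity it would give the edge
-- (v₁→v₀ , v₃→v₄), and then no face covers the prism T = {v₁,v₃}, H = {v₀,v₂,v₄},
-- since with the nesting edges every choice of its square diagonals yields two
-- edges with a common midpoint and no common vertex (no-crossing, cyclic-choice).
-- Uniformity spreads the crossing diagonal to all HTTH pairs; THHT is the mirror
-- image.

open import Defs
open import Level using (0ℓ)
open import Data.Nat using (ℕ; zero; suc; _≤_; s≤s; z≤n)
import Data.Nat as Nat
import Data.Nat.Properties as Nat
open import Data.Fin using (Fin; zero; suc; _≟_; _<_; #_)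
open import Data.Fin.Patterns using (0F; 1F; 2F; 3F)
import Data.Fin.Properties as Fin
import Data.Integer as ℤ
open import Data.Rational using (ℚ; 0ℚ; 1ℚ; ½; _+_; _*_; _-_; -_; _/_; 1/_; NonZero; ≢-nonZero; nonNegative)
  renaming (_≤_ to _≤ℚ_)
import Data.Rational.Properties as ℚ
open import Data.Rational.Solver using (module +-*-Solver)
open import Algebra.Bundles using (CommutativeRing)
import Algebra.Properties.Semiring.Sum as SemiringSum
open import Data.Unit using (tt)
open import Data.Empty using (⊥; ⊥-elim)
open import Data.Product using (∃; _×_; _,_; proj₁; proj₂; uncurry)
open import Data.Sum using (_⊎_; inj₁; inj₂; [_,_])
import Data.Sum as Sum
open import Data.List using (List; []; _∷_; length; lookup)
open import Data.List.Membership.Propositional using (_∈_; lose)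
open import Data.List.Membership.Propositional.Properties using (∈-lookup)
open import Data.List.Relation.Unary.All as All using (All; []; _∷_)
open import Data.List.Relation.Unary.Any using (Any; here; there; toSum)
open import Data.List.Relation.Unary.Any.Properties using (singleton⁻)
open import Data.List.Relation.Unary.AllPairs using (AllPairs; []; _∷_)
open import Data.List.Relation.Unary.Linked using (Linked; [-]; _∷_)
open import Data.List.Relation.Unary.Linked.Properties using (Linked⇒AllPairs)
open import Function using (_∘_; id; _⇔_; mk⇔; Equivalence)
import Function.Properties.Equivalence as ⇔
open import Relation.Nullary using (¬_; Dec; yes; no; contradiction)
open import Relation.Nullary.Decidable using (True; toWitness; ¬?)
open import Relation.Binary.Core using (Rel)
open import Relation.Binary.Definitions using (tri<; tri≈; tri>)
open import Relation.Binary.PropositionalEquality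
  using (_≡_; _≢_; refl; sym; trans; cong; cong₂; subst; module ≡-Reasoning)

open +-*-Solver using (solve; _:+_; _:*_; _:-_; :-_; _:=_; con)
open SemiringSum (CommutativeRing.semiring ℚ.+-*-commutativeRing)
  using (sum; sum-cong-≗; sum-replicate-zero; ∑-comm; ∑-distrib-+; *-distribˡ-sum)

∑≡sum : ∀ {m} (f : Fin m → ℚ) → ∑ f ≡ sum f
∑≡sum {zero}  f = refl
∑≡sum {suc m} f = cong (f zero +_) (∑≡sum (f ∘ suc))

via-sum : ∀ {m p} {f : Fin m → ℚ} {g : Fin p → ℚ} → sum f ≡ sum g → ∑ f ≡ ∑ g
via-sum {f = f} {g} eq = trans (∑≡sum f) (trans eq (sym (∑≡sum g)))

∑-cong : ∀ {m} {f g : Fin m → ℚ} → (∀ k → f k ≡ g k) → ∑ f ≡ ∑ g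
∑-cong {f = f} {g} f≗g = via-sum {f = f} {g} (sum-cong-≗ f≗g)

∑-zero : ∀ m → ∑ {m} (λ _ → 0ℚ) ≡ 0ℚ
∑-zero m = trans (∑≡sum {m} (λ _ → 0ℚ)) (sum-replicate-zero m)

∑-+ : ∀ {m} (f g : Fin m → ℚ) → ∑ (λ k → f k + g k) ≡ ∑ f + ∑ g
∑-+ f g = trans (∑≡sum (λ k → f k + g k))
  (trans (∑-distrib-+ f g) (sym (cong₂ _+_ (∑≡sum f) (∑≡sum g))))

∑-scale : ∀ {m} (a : ℚ) (f : Fin m → ℚ) → ∑ (λ k → a * f k) ≡ a * ∑ f
∑-scale a f = trans (∑≡sum (λ k → a * f k))
  (trans (sym (*-distribˡ-sum a f)) (cong (a *_) (sym (∑≡sum f))))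

∑-swap : ∀ {m p} (f : Fin m → Fin p → ℚ) →
  ∑ (λ k → ∑ (λ t → f k t)) ≡ ∑ (λ t → ∑ (λ k → f k t))
∑-swap f = begin
  ∑ (λ k → ∑ (f k))            ≡⟨ ∑-cong (λ k → ∑≡sum (f k)) ⟩
  ∑ (λ k → sum (f k))          ≡⟨ via-sum {f = λ k → sum (f k)} {λ t → sum (λ k → f k t)} (∑-comm f) ⟩
  ∑ (λ t → sum (λ k → f k t))  ≡⟨ ∑-cong (λ t → sym (∑≡sum (λ k → f k t))) ⟩
  ∑ (λ t → ∑ (λ k → f k t))    ∎
  where open ≡-Reasoning

∑-mono-≤ : ∀ {m} {f g : Fin m → ℚ} → (∀ k → f k ≤ℚ g k) → ∑ f ≤ℚ ∑ g
∑-mono-≤ {zero}  f≤g = ℚ.≤-refl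
∑-mono-≤ {suc m} f≤g = ℚ.+-mono-≤ (f≤g zero) (∑-mono-≤ (f≤g ∘ suc))

+-tight : ∀ {a b c d : ℚ} → a ≤ℚ b → c ≤ℚ d → a + c ≡ b + d → a ≡ b × c ≡ d
+-tight a≤b c≤d eq =
  ℚ.≤-antisym a≤b (ℚ.≮⇒≥ λ a<b → ℚ.<-irrefl eq (ℚ.+-mono-<-≤ a<b c≤d)) ,
  ℚ.≤-antisym c≤d (ℚ.≮⇒≥ λ c<d → ℚ.<-irrefl eq (ℚ.+-mono-≤-< a≤b c<d))

∑-tight : ∀ {m} {f g : Fin m → ℚ} → (∀ k → f k ≤ℚ g k) → ∑ f ≡ ∑ g →
  ∀ k → f k ≡ g k
∑-tight {suc m} f≤g eq zero    = proj₁ (+-tight (f≤g zero) (∑-mono-≤ (f≤g ∘ suc)) eq)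
∑-tight {suc m} f≤g eq (suc k) =
  ∑-tight (f≤g ∘ suc) (proj₂ (+-tight (f≤g zero) (∑-mono-≤ (f≤g ∘ suc)) eq)) k

∑-nonzero : ∀ {m} (f : Fin m → ℚ) → ∑ f ≢ 0ℚ → ∃ λ k → f k ≢ 0ℚ
∑-nonzero {zero}  f ∑≢0 = contradiction refl ∑≢0
∑-nonzero {suc m} f ∑≢0 with f zero ℚ.≟ 0ℚ
... | no f₀≢0 = zero , f₀≢0
... | yes f₀≡0 with ∑-nonzero (f ∘ suc) (λ rest≡0 → ∑≢0 (cong₂ _+_ f₀≡0 rest≡0))
...   | k , fk≢0 = suc k , fk≢0

∑-convex-const : ∀ {m} (λc : Fin m → ℚ) (M : ℚ) → ∑ λc ≡ 1ℚ → ∑ (λ t → λc t * M) ≡ M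
∑-convex-const λc M ∑λc≡1 = begin
  ∑ (λ t → λc t * M)  ≡⟨ ∑-cong (λ t → ℚ.*-comm (λc t) M) ⟩
  ∑ (λ t → M * λc t)  ≡⟨ ∑-scale M λc ⟩
  M * ∑ λc            ≡⟨ cong (M *_) ∑λc≡1 ⟩
  M * 1ℚ              ≡⟨ ℚ.*-identityʳ M ⟩
  M                   ∎
  where open ≡-Reasoning

*-cancelˡ-≢0 : ∀ {p q r : ℚ} → p ≢ 0ℚ → p * q ≡ p * r → q ≡ r
*-cancelˡ-≢0 {p} {q} {r} p≢0 pq≡pr = begin
  q              ≡⟨ sym (recover q) ⟩
  p⁻¹ * (p * q)  ≡⟨ cong (p⁻¹ *_) pq≡pr ⟩
  p⁻¹ * (p * r)  ≡⟨ recover r ⟩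
  r              ∎
  where
  open ≡-Reasoning
  instance
    p-nonZero : NonZero p
    p-nonZero = ≢-nonZero p≢0
  p⁻¹ : ℚ
  p⁻¹ = 1/ p
  recover : ∀ s → p⁻¹ * (p * s) ≡ s
  recover s = trans (sym (ℚ.*-assoc p⁻¹ p s))
    (trans (cong (_* s) (ℚ.*-inverseˡ p)) (ℚ.*-identityˡ s))

e-shift : ∀ {n} (j k : Fin (suc n)) → e (suc j) (suc k) ≡ e j k
e-shift j k with k ≟ j
... | yes _ = refl
... | no _  = refl

∑-sift : ∀ {n} (f : Fin (suc n) → ℚ) (j : Fin (suc n)) → ∑ (λ k → f k * e j k) ≡ f j
∑-sift {n} f zero = begin
  f zero * 1ℚ + ∑ (λ k → f (suc k) * 0ℚ)  ≡⟨ cong₂ _+_ (ℚ.*-identityʳ (f zero))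
                                                 (∑-cong (ℚ.*-zeroʳ ∘ f ∘ suc)) ⟩
  f zero + ∑ {n} (λ _ → 0ℚ)               ≡⟨ cong (f zero +_) (∑-zero n) ⟩
  f zero + 0ℚ                             ≡⟨ ℚ.+-identityʳ (f zero) ⟩
  f zero                                  ∎
  where open ≡-Reasoning
∑-sift {suc n} f (suc j) = begin
  f zero * 0ℚ + ∑ (λ k → f (suc k) * e (suc j) (suc k))
    ≡⟨ cong₂ _+_ (ℚ.*-zeroʳ (f zero)) (∑-cong (λ k → cong (f (suc k) *_) (e-shift j k))) ⟩
  0ℚ + ∑ (λ k → f (suc k) * e j k)  ≡⟨ ℚ.+-identityˡ _ ⟩
  ∑ (λ k → f (suc k) * e j k)       ≡⟨ ∑-sift (f ∘ suc) j ⟩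
  f (suc j)                         ∎
  where open ≡-Reasoning

dot-vec : ∀ {n} (c : Point n) (a : Arrow n) → dot c (vec a) ≡ c (head a) - c (tail a)
dot-vec {n} c a = begin
  ∑ (λ k → c k * (e h k - e t k))                    ≡⟨ ∑-cong split ⟩
  ∑ (λ k → c k * e h k + (- c k) * e t k)            ≡⟨ ∑-+ (λ k → c k * e h k) (λ k → (- c k) * e t k) ⟩
  ∑ (λ k → c k * e h k) + ∑ (λ k → (- c k) * e t k)  ≡⟨ cong₂ _+_ (∑-sift c h) (∑-sift (-_ ∘ c) t) ⟩
  c h - c t                                          ∎
  where
  open ≡-Reasoning
  h t : Fin (suc n)
  h = head a
  t = tail a
  split : ∀ k → c k * (e h k - e t k) ≡ c k * e h k + (- c k) * e t k
  split k = solve 3 (λ x y z → x :* (y :- z) := x :* y :+ (:- x) :* z) refl (c k) (e h k) (e t k)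

dot-combo : ∀ {n} (c : Point n) (F : List (Arrow n)) (λc : Fin (length F) → ℚ) →
  dot c (combo F λc) ≡ ∑ (λ t → λc t * dot c (vec (lookup F t)))
dot-combo {n} c F λc = begin
  ∑ (λ k → c k * ∑ (λ t → λc t * v t k))    ≡⟨ ∑-cong (λ k → sym (∑-scale (c k) (λ t → λc t * v t k))) ⟩
  ∑ (λ k → ∑ (λ t → c k * (λc t * v t k)))  ≡⟨ ∑-swap (λ k t → c k * (λc t * v t k)) ⟩
  ∑ (λ t → ∑ (λ k → c k * (λc t * v t k)))  ≡⟨ ∑-cong (λ t → ∑-cong (λ k → reorder (c k) (λc t) (v t k))) ⟩
  ∑ (λ t → ∑ (λ k → λc t * (c k * v t k)))  ≡⟨ ∑-cong (λ t → ∑-scale (λc t) (λ k → c k * v t k)) ⟩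
  ∑ (λ t → λc t * dot c (v t))              ∎
  where
  open ≡-Reasoning
  v : Fin (length F) → Point n
  v t = vec (lookup F t)
  reorder : ∀ x y z → x * (y * z) ≡ y * (x * z)
  reorder = solve 3 (λ x y z → x :* (y :* z) := y :* (x :* z)) refl

face-support : ∀ {n} (c : Point n) (M : ℚ) → (∀ a → dot c (vec a) ≤ℚ M) →
  ∀ F {x} (ic : InConv F x) → dot c x ≡ M →
  ∀ t → proj₁ ic t ≢ 0ℚ → dot c (vec (lookup F t)) ≡ M
face-support c M bound F (λc , λc≥0 , ∑λc≡1 , combo≡x) cx≡M t λt≢0 =
  *-cancelˡ-≢0 λt≢0 (∑-tight below (trans attained (sym (∑-convex-const λc M ∑λc≡1))) t)
  where
  d : Fin (length F) → ℚ
  d t = dot c (vec (lookup F t))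
  below : ∀ t → λc t * d t ≤ℚ λc t * M
  below t = ℚ.*-monoˡ-≤-nonNeg (λc t) {{nonNegative (λc≥0 t)}} (bound (lookup F t))
  attained : ∑ (λ t → λc t * d t) ≡ M
  attained = trans (sym (dot-combo c F λc))
    (trans (∑-cong (λ k → cong (c k *_) (combo≡x k))) cx≡M)

touching : ∀ {n} (F : List (Arrow n)) {x : Point n} (ic : InConv F x) (j : Fin (suc n)) →
  x j ≢ 0ℚ → ∃ λ t → proj₁ ic t ≢ 0ℚ × (head (lookup F t) ≡ j ⊎ tail (lookup F t) ≡ j)
touching F (λc , _ , _ , combo≡x) j xj≢0
  with ∑-nonzero (λ t → λc t * vec (lookup F t) j) (λ ∑≡0 → xj≢0 (trans (sym (combo≡x j)) ∑≡0))
... | t , term≢0 = t , weight≢0 , endpoint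
  where
  weight≢0 : λc t ≢ 0ℚ
  weight≢0 λt≡0 = term≢0 (trans (cong (_* vec (lookup F t) j) λt≡0) (ℚ.*-zeroˡ (vec (lookup F t) j)))
  endpoint : head (lookup F t) ≡ j ⊎ tail (lookup F t) ≡ j
  endpoint with j ≟ head (lookup F t) | j ≟ tail (lookup F t)
  ... | yes j≡h | _       = inj₁ (sym j≡h)
  ... | no _    | yes j≡t = inj₂ (sym j≡t)
  ... | no _    | no _    = contradiction (ℚ.*-zeroʳ (λc t)) term≢0

data Sign : Set where
  P Z N : Sign

val : Sign → ℚ
val P = 1ℚ
val Z = 0ℚ
val N = - 1ℚ

2ℚ : ℚ
2ℚ = 1ℚ + 1ℚ

val≤1 : ∀ s → val s ≤ℚ 1ℚ
val≤1 P = ℚ.≤ᵇ⇒≤ tt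
val≤1 Z = ℚ.≤ᵇ⇒≤ tt
val≤1 N = ℚ.≤ᵇ⇒≤ tt

-val≤1 : ∀ s → - val s ≤ℚ 1ℚ
-val≤1 P = ℚ.≤ᵇ⇒≤ tt
-val≤1 Z = ℚ.≤ᵇ⇒≤ tt
-val≤1 N = ℚ.≤ᵇ⇒≤ tt

val-gap≤2 : ∀ s s′ → val s - val s′ ≤ℚ 2ℚ
val-gap≤2 s s′ = ℚ.+-mono-≤ (val≤1 s) (-val≤1 s′)

val-gap≡2 : ∀ s s′ → val s - val s′ ≡ 2ℚ → s ≡ P × s′ ≡ N
val-gap≡2 P N _ = refl , refl
val-gap≡2 P P ()
val-gap≡2 P Z ()
val-gap≡2 Z P ()
val-gap≡2 Z Z ()
val-gap≡2 Z N ()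
val-gap≡2 N P ()
val-gap≡2 N Z ()
val-gap≡2 N N ()

P≢N : P ≢ N
P≢N ()

Joins : ∀ {n} → List (Arrow n) → Fin (suc n) → Fin (suc n) → Set
Joins F i j = ∃ λ a → a ∈ F × tail a ≡ i × head a ≡ j

reverse : ∀ {n} → Arrow n → Arrow n
reverse (arrow i j i≢j) = arrow j i (λ j≡i → i≢j (sym j≡i))

-- The sign vector that is P on H, N on T (outside H) and Z elsewhere.  Its
-- functional ĉ is at most 2 on P_n, and its top face (where ĉ = 2) is the
-- convex hull of the arrows from T to H.
module SignedFace {n : ℕ} (H T : List (Fin (suc n))) where

  open import Data.List.Membership.DecPropositional (_≟_ {suc n}) using (_∈?_)

  signOf : ∀ {k} → Dec (k ∈ H) → Dec (k ∈ T) → Sign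
  signOf (yes _) _       = P
  signOf (no _)  (yes _) = N
  signOf (no _)  (no _)  = Z

  sign : Fin (suc n) → Sign
  sign k = signOf (k ∈? H) (k ∈? T)

  sign-P : ∀ {k} → sign k ≡ P → k ∈ H
  sign-P {k} = from (k ∈? H) (k ∈? T)
    where
    from : (k∈?H : Dec (k ∈ H)) (k∈?T : Dec (k ∈ T)) → signOf k∈?H k∈?T ≡ P → k ∈ H
    from (yes k∈H) _      _ = k∈H
    from (no _)   (yes _) ()
    from (no _)   (no _)  ()

  sign-N : ∀ {k} → sign k ≡ N → k ∈ T
  sign-N {k} = from (k ∈? H) (k ∈? T)
    where
    from : (k∈?H : Dec (k ∈ H)) (k∈?T : Dec (k ∈ T)) → signOf k∈?H k∈?T ≡ N → k ∈ T
    from (yes _) _         ()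
    from (no _)  (yes k∈T) _ = k∈T
    from (no _)  (no _)    ()

  ĉ : Point n
  ĉ k = val (sign k)

  height : Arrow n → ℚ
  height a = val (sign (head a)) - val (sign (tail a))

  ĉ-height : ∀ a → dot ĉ (vec a) ≡ height a
  ĉ-height = dot-vec ĉ

  height≤2 : ∀ a → dot ĉ (vec a) ≤ℚ 2ℚ
  height≤2 a = subst (_≤ℚ 2ℚ) (sym (ĉ-height a)) (val-gap≤2 (sign (head a)) (sign (tail a)))

  top-arrow : ∀ a → dot ĉ (vec a) ≡ 2ℚ → sign (head a) ≡ P × sign (tail a) ≡ N
  top-arrow a top = val-gap≡2 _ _ (trans (sym (ĉ-height a)) top)

  on-top : ∀ {L x} (ic : InConv L x) → All (λ a → height a ≡ 2ℚ) L → dot ĉ x ≡ 2ℚ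
  on-top {L} {x} (λc , _ , ∑λc≡1 , combo≡x) tops = begin
    dot ĉ x                                    ≡⟨ ∑-cong (λ k → cong (ĉ k *_) (sym (combo≡x k))) ⟩
    dot ĉ (combo L λc)                         ≡⟨ dot-combo ĉ L λc ⟩
    ∑ (λ t → λc t * dot ĉ (vec (lookup L t)))  ≡⟨ ∑-cong (λ t → cong (λc t *_) (arrow-on-top t)) ⟩
    ∑ (λ t → λc t * 2ℚ)                        ≡⟨ ∑-convex-const λc 2ℚ ∑λc≡1 ⟩
    2ℚ                                         ∎
    where
    open ≡-Reasoning
    arrow-on-top : ∀ t → dot ĉ (vec (lookup L t)) ≡ 2ℚ
    arrow-on-top t = trans (ĉ-height (lookup L t)) (All.lookup tops (∈-lookup t))

  on-boundary : ∀ {a L x} → InConv (a ∷ L) x → All (λ b → height b ≡ 2ℚ) (a ∷ L) →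
    InBoundary n x
  on-boundary {a} {L} {x} ic tops@(a-top ∷ _) =
    (a ∷ L , ic) , ĉ , (a , reverse a , non-constant) , below
    where
    a-on-top : dot ĉ (vec a) ≡ 2ℚ
    a-on-top = trans (ĉ-height a) a-top
    non-constant : dot ĉ (vec a) ≢ dot ĉ (vec (reverse a))
    non-constant eq = P≢N (trans (sym tail-P) (proj₂ (top-arrow a a-on-top)))
      where
      tail-P : sign (tail a) ≡ P
      tail-P = proj₁ (top-arrow (reverse a) (trans (sym eq) a-on-top))
    below : ∀ b → dot ĉ (vec b) ≤ℚ dot ĉ x
    below b = subst (dot ĉ (vec b) ≤ℚ_) (sym (on-top ic tops)) (height≤2 b)

  TopArrowAt : List (Arrow n) → Fin (suc n) → Set
  TopArrowAt F j = ∃ λ a → a ∈ F × (sign (head a) ≡ P × sign (tail a) ≡ N) × (head a ≡ j ⊎ tail a ≡ j)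

  top-touch : ∀ F {x} (ic : InConv F x) → dot ĉ x ≡ 2ℚ → ∀ j → x j ≢ 0ℚ → TopArrowAt F j
  top-touch F ic top j xj≢0 with touching F ic j xj≢0
  ... | t , λt≢0 , at-j =
    lookup F t , ∈-lookup t , top-arrow (lookup F t) (face-support ĉ 2ℚ height≤2 F ic top t λt≢0) , at-j

  inward : ∀ F {x} (ic : InConv F x) → dot ĉ x ≡ 2ℚ → ∀ j → sign j ≡ P → x j ≢ 0ℚ →
    Any (λ i → Joins F i j) T
  inward F ic top j jP xj≢0 = entered (top-touch F ic top j xj≢0)
    where
    entered : TopArrowAt F j → Any (λ i → Joins F i j) T
    entered (a , a∈F , (_ , tN) , inj₁ h≡j) = lose (sign-N tN) (a , a∈F , refl , h≡j)
    entered (a , a∈F , (_ , tN) , inj₂ t≡j) =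
      contradiction (trans (sym jP) (trans (cong sign (sym t≡j)) tN)) P≢N

  outward : ∀ F {x} (ic : InConv F x) → dot ĉ x ≡ 2ℚ → ∀ i → sign i ≡ N → x i ≢ 0ℚ →
    Any (λ j → Joins F i j) H
  outward F ic top i iN xi≢0 = left (top-touch F ic top i xi≢0)
    where
    left : TopArrowAt F i → Any (λ j → Joins F i j) H
    left (a , a∈F , (hP , _) , inj₂ t≡i) = lose (sign-P hP) (a , a∈F , t≡i , refl)
    left (a , a∈F , (hP , _) , inj₁ h≡i) =
      contradiction (trans (sym hP) (trans (cong sign h≡i) iN)) P≢N

  record TopCover (E : Rel (Arrow n) 0ℓ) (x : Point n) : Set where
    field
      F     : List (Arrow n)
      flag  : FlagFace E F
      enter : ∀ j → sign j ≡ P → x j ≢ 0ℚ → Any (λ i → Joins F i j) T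
      leave : ∀ i → sign i ≡ N → x i ≢ 0ℚ → Any (λ j → Joins F i j) H

  top-cover : ∀ {E} → RepresentsTriangulation n (FlagFace E) →
    ∀ {a L x} → InConv (a ∷ L) x → All (λ b → height b ≡ 2ℚ) (a ∷ L) → TopCover E x
  top-cover {E} tri {x = x} ic tops = record
    { F     = proj₁ covering
    ; flag  = proj₁ (proj₂ covering)
    ; enter = inward (proj₁ covering) (proj₂ (proj₂ covering)) (on-top ic tops)
    ; leave = outward (proj₁ covering) (proj₂ (proj₂ covering)) (on-top ic tops)
    }
    where
    covering : ∃ λ G → FlagFace E G × InConv G x
    covering = RepresentsTriangulation.covers tri x (on-boundary ic tops)

allPairs-∈ : ∀ {A : Set} {R : Rel A 0ℓ} {xs : List A} {x y : A} →
  AllPairs R xs → x ∈ xs → y ∈ xs → x ≢ y → R x y ⊎ R y x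
allPairs-∈ (_ ∷ _)   (here refl) (here refl) x≢y = contradiction refl x≢y
allPairs-∈ (Rx ∷ _)  (here refl) (there y∈)  _   = inj₁ (All.lookup Rx y∈)
allPairs-∈ (Ry ∷ _)  (there x∈)  (here refl) _   = inj₂ (All.lookup Ry x∈)
allPairs-∈ (_ ∷ Rxs) (there x∈)  (there y∈)  x≢y = allPairs-∈ Rxs x∈ y∈ x≢y

adjacent : ∀ {n} {E : Rel (Arrow n) 0ℓ} → Symmetric E → ∀ {F} → FlagFace E F →
  ∀ {a b} → Joins F (tail a) (head a) → Joins F (tail b) (head b) → a ≢ b → E a b
adjacent sym-E (_ , pairs) {arrow _ _ _} {arrow _ _ _} (_ , a∈F , refl , refl) (_ , b∈F , refl , refl) a≢b =
  [ id , sym-E _ _ ] (allPairs-∈ pairs a∈F b∈F a≢b)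

edge-face : ∀ {n} {E : Rel (Arrow n) 0ℓ} {a b} → a ≢ b → E a b → FlagFace E (a ∷ b ∷ [])
edge-face a≢b Eab = ((a≢b ∷ []) ∷ [] ∷ []) , ((Eab ∷ []) ∷ [] ∷ [])

HeadsSwapped : ∀ {n} → Arrow n → Arrow n → Arrow n → Arrow n → Set
HeadsSwapped a b c d = tail c ≡ tail a × head c ≡ head b × tail d ≡ tail b × head d ≡ head a

-- No-crossing lemma: for a = i→j, b = k→l with i ≠ k, j ≠ l, the segments
-- [a , b] and [i→l , k→j] have the same midpoint but no common vertex, so in
-- a triangulation they cannot both be edges.
no-crossing : ∀ {n} {E : Rel (Arrow n) 0ℓ} → RepresentsTriangulation n (FlagFace E) →
  ∀ {a b c d} → HeadsSwapped a b c d → tail a ≢ tail b → head a ≢ head b →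
  E a b → E c d → ⊥
no-crossing {n} tri {a@(arrow i j _)} {b@(arrow k l _)} {c@(arrow _ _ _)} {d@(arrow _ _ _)}
  (refl , refl , refl , refl) i≢k j≢l E₁ E₂ =
  common-arrow (RepresentsTriangulation.intersect tri (a ∷ b ∷ []) (c ∷ d ∷ []) midpoint
    (edge-face (i≢k ∘ cong tail) E₁) (edge-face (i≢k ∘ cong tail) E₂) on-ab on-cd)
  where
  halves : Fin 2 → ℚ
  halves _ = ½
  midpoint : Point n
  midpoint = combo (a ∷ b ∷ []) halves
  on-ab : InConv (a ∷ b ∷ []) midpoint
  on-ab = halves , (λ _ → ℚ.≤ᵇ⇒≤ tt) , refl , λ _ → refl
  on-cd : InConv (c ∷ d ∷ []) midpoint
  on-cd = halves , (λ _ → ℚ.≤ᵇ⇒≤ tt) , refl , same-midpoint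
    where
    same-midpoint : ∀ p → combo (c ∷ d ∷ []) halves p ≡ midpoint p
    same-midpoint p = solve 5 (λ h J I L K → h :* (L :- I) :+ (h :* (J :- K) :+ con 0ℚ)
                                          := h :* (J :- I) :+ (h :* (L :- K) :+ con 0ℚ))
                              refl ½ (e j p) (e i p) (e l p) (e k p)
  disjoint : ∀ {v} → v ∈ a ∷ b ∷ [] → v ∈ c ∷ d ∷ [] → ⊥
  disjoint (here refl)         (here a≡c)         = j≢l (cong head a≡c)
  disjoint (here refl)         (there (here a≡d)) = i≢k (cong tail a≡d)
  disjoint (there (here refl)) (here b≡c)         = i≢k (sym (cong tail b≡c))
  disjoint (there (here refl)) (there (here b≡d)) = j≢l (sym (cong head b≡d))
  -- the common face given by the triangulation is nonempty, as it has the
  -- midpoint in its hull (an empty sum of weights is 0, not 1)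
  common-arrow : (∃ λ G → (∀ v → v ∈ G → (v ∈ a ∷ b ∷ []) × (v ∈ c ∷ d ∷ [])) × InConv G midpoint) → ⊥
  common-arrow ([] , _ , (_ , _ , () , _))
  common-arrow (v ∷ _ , common , _) = uncurry disjoint (common v (here refl))

Increasing : ∀ {k n} → (Fin k → Fin (suc n)) → Set
Increasing f = ∀ {p q} → p < q → f p < f q

increasing-reflects-< : ∀ {k n} {f : Fin k → Fin (suc n)} → Increasing f →
  ∀ p q → (f p < f q ⇔ p < q)
increasing-reflects-< {f = f} f↑ p q = mk⇔ reflect f↑
  where
  reflect : f p < f q → p < q
  reflect fp<fq with Fin.<-cmp p q
  ... | tri< p<q _ _ = p<q
  ... | tri≈ _ refl _ = contradiction fp<fq (Fin.<-irrefl refl)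
  ... | tri> _ _ q<p = contradiction (f↑ q<p) (Fin.<-asym fp<fq)

increasing-reflects-≡ : ∀ {k n} {f : Fin k → Fin (suc n)} → Increasing f →
  ∀ p q → (f p ≡ f q ⇔ p ≡ q)
increasing-reflects-≡ {f = f} f↑ p q = mk⇔ reflect (cong f)
  where
  reflect : f p ≡ f q → p ≡ q
  reflect fp≡fq with Fin.<-cmp p q
  ... | tri< p<q _ _ = contradiction (f↑ p<q) (Fin.<-irrefl fp≡fq)
  ... | tri≈ _ p≡q _ = p≡q
  ... | tri> _ _ q<p = contradiction (f↑ q<p) (Fin.<-irrefl (sym fp≡fq))

chain-increasing : ∀ {n} {xs : List (Fin (suc n))} → Linked _<_ xs → Increasing (lookup xs)
chain-increasing = sorted ∘ Linked⇒AllPairs Fin.<-trans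
  where
  sorted : ∀ {n} {xs : List (Fin (suc n))} → AllPairs _<_ xs → Increasing (lookup xs)
  sorted {xs = _ ∷ _} (x<xs ∷ _)     {zero}  {suc q} _         = All.lookup x<xs (∈-lookup q)
  sorted {xs = _ ∷ _} (_ ∷ xs-sorted) {suc p} {suc q} (s≤s p<q) = sorted xs-sorted p<q

quad-≗ : ∀ {n} {a b : Arrow n} {f : Fin 4 → Fin (suc n)} →
  tail a ≡ f 0F → head a ≡ f 1F → tail b ≡ f 2F → head b ≡ f 3F → ∀ p → quad a b p ≡ f p
quad-≗ t₀ _  _  _  zero                   = t₀
quad-≗ _  h₁ _  _  (suc zero)             = h₁
quad-≗ _  _  t₂ _  (suc (suc zero))       = t₂
quad-≗ _  _  _  h₃ (suc (suc (suc zero))) = h₃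

same-order : ∀ {k n} {f g : Fin k → Fin (suc n)} → Increasing f → Increasing g →
  (π : Fin 4 → Fin k) → ∀ {a b a′ b′} →
  (∀ p → quad a b p ≡ f (π p)) → (∀ p → quad a′ b′ p ≡ g (π p)) → SameOrderType a b a′ b′
same-order {f = f} {g} f↑ g↑ π {a} {b} {a′} {b′} qa qb p q =
  through _<_ (increasing-reflects-< f↑ (π p) (π q)) (increasing-reflects-< g↑ (π p) (π q)) ,
  through _≡_ (increasing-reflects-≡ f↑ (π p) (π q)) (increasing-reflects-≡ g↑ (π p) (π q))
  where
  relabel : ∀ {A : Set} (R : Rel A 0ℓ) {x y x′ y′} → x ≡ x′ → y ≡ y′ → R x y ⇔ R x′ y′
  relabel R refl refl = ⇔.refl
  through : ∀ (R : Rel (Fin _) 0ℓ) {X : Set} → R (f (π p)) (f (π q)) ⇔ X → R (g (π p)) (g (π q)) ⇔ X →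
    R (quad a b p) (quad a b q) ⇔ R (quad a′ b′ p) (quad a′ b′ q)
  through R viaF viaG = ⇔.trans (relabel R (qa p) (qa q))
    (⇔.trans viaF (⇔.trans (⇔.sym viaG) (relabel R (sym (qb p)) (sym (qb q)))))

arrow-ext : ∀ {n} {a b : Arrow n} → tail a ≡ tail b → head a ≡ head b → a ≡ b
arrow-ext {a = arrow _ _ _} {arrow _ _ _} refl refl = refl

-- Uniformity transports edges between pairs with the same endpoint pattern
-- (distinctness of the target pair follows from the shared order type).
uniform-transfer : ∀ {n k} {E : Rel (Arrow n) 0ℓ} → Uniform E →
  {f g : Fin k → Fin (suc n)} → Increasing f → Increasing g → (π : Fin 4 → Fin k) →
  ∀ {a b a′ b′} → (∀ p → quad a b p ≡ f (π p)) → (∀ p → quad a′ b′ p ≡ g (π p)) →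
  a ≢ b → E a b → E a′ b′
uniform-transfer uni f↑ g↑ π {a} {b} {a′} {b′} qa qb a≢b = uni a b a′ b′ a≢b a′≢b′ same
  where
  same : SameOrderType a b a′ b′
  same = same-order f↑ g↑ π qa qb
  a′≢b′ : a′ ≢ b′
  a′≢b′ a′≡b′ = a≢b (arrow-ext (Equivalence.from (proj₂ (same 0F 2F)) (cong tail a′≡b′))
                               (Equivalence.from (proj₂ (same 1F 3F)) (cong head a′≡b′)))

-- A square of four arrows whose four corners are all covered is covered by
-- one of its two diagonals (A,D or B,C).
square-diagonal : ∀ {A B C D : Set} → A ⊎ C → B ⊎ D → A ⊎ B → C ⊎ D → (A × D) ⊎ (B × C)
square-diagonal _        _        (inj₁ a) (inj₂ d) = inj₁ (a , d)
square-diagonal _        (inj₁ b) (inj₁ a) (inj₁ c) = inj₂ (b , c)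
square-diagonal _        (inj₂ d) (inj₁ a) (inj₁ c) = inj₁ (a , d)
square-diagonal (inj₂ c) _        (inj₂ b) _        = inj₂ (b , c)
square-diagonal (inj₁ a) _        (inj₂ b) (inj₁ c) = inj₂ (b , c)
square-diagonal (inj₁ a) _        (inj₂ b) (inj₂ d) = inj₁ (a , d)

forced : ∀ {A B : Set} → A ⊎ B → ¬ B → A
forced a⊎b ¬b = [ id , ⊥-elim ∘ ¬b ] a⊎b

forced′ : ∀ {A B : Set} → A ⊎ B → ¬ A → B
forced′ a⊎b ¬a = [ ⊥-elim ∘ ¬a , id ] a⊎b

-- Three choices Xᵢ ⊎ Yᵢ, with some X and some Y chosen, cannot avoid all of
-- the cyclically forbidden combinations Xᵢ × Yᵢ₊₁ (the three square
-- diagonals of a triangulated prism are not cyclically oriented).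
cyclic-choice : ∀ {X₀ X₁ X₂ Y₀ Y₁ Y₂ : Set} →
  X₀ ⊎ Y₀ → X₁ ⊎ Y₁ → X₂ ⊎ Y₂ → X₀ ⊎ X₁ ⊎ X₂ → Y₀ ⊎ Y₁ ⊎ Y₂ →
  ¬ (X₀ × Y₁) → ¬ (X₁ × Y₂) → ¬ (X₂ × Y₀) → ⊥
cyclic-choice {X₀} {X₁} {X₂} {Y₀} {Y₁} {Y₂} c₀ c₁ c₂ xs ys n₀₁ n₁₂ n₂₀ = [ all-X , all-Y ] c₀
  where
  all-X : X₀ → ⊥
  all-X x₀ = [ n₂₀ ∘ (x₂ ,_) , [ n₀₁ ∘ (x₀ ,_) , n₁₂ ∘ (x₁ ,_) ] ] ys
    where
    x₁ : X₁
    x₁ = forced c₁ (n₀₁ ∘ (x₀ ,_))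
    x₂ : X₂
    x₂ = forced c₂ (n₁₂ ∘ (x₁ ,_))
  all-Y : Y₀ → ⊥
  all-Y y₀ = [ n₀₁ ∘ (_, y₁) , [ n₁₂ ∘ (_, y₂) , n₂₀ ∘ (_, y₀) ] ] xs
    where
    y₂ : Y₂
    y₂ = forced′ c₂ (n₂₀ ∘ (_, y₀))
    y₁ : Y₁
    y₁ = forced′ c₁ (n₁₂ ∘ (_, y₂))

barycentric : ∀ {n} (L : List (Arrow n)) (w : ℚ) → 0ℚ ≤ℚ w → ∑ {length L} (λ _ → w) ≡ 1ℚ →
  InConv L (combo L (λ _ → w))
barycentric L w w≥0 ∑≡1 = (λ _ → w) , (λ _ → w≥0) , ∑≡1 , (λ _ → refl)

¼ ⅙ : ℚ
¼ = ℤ.+ 1 / 4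
⅙ = ℤ.+ 1 / 6

any₂ : ∀ {A : Set} {P : A → Set} {x y : A} → Any P (x ∷ y ∷ []) → P x ⊎ P y
any₂ = Sum.map₂ singleton⁻ ∘ toSum

any₃ : ∀ {A : Set} {P : A → Set} {x y z : A} → Any P (x ∷ y ∷ z ∷ []) → P x ⊎ P y ⊎ P z
any₃ = Sum.map₂ any₂ ∘ toSum

-- The configurations on the first five points v₀ < … < v₄.  The side
-- conditions about signs (refl) and nonvanishing coordinates of barycentres
-- (λ ()) are decided by evaluation.
module FivePoints (m : ℕ) {E : Rel (Arrow (4 Nat.+ m)) 0ℓ} (sym-E : Symmetric E) (uni : Uniform E)
  (tri : RepresentsTriangulation (4 Nat.+ m) (FlagFace E))
  (nest-THTH : NestsTHTH E) (nest-HTHT : NestsHTHT E) where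

  Pt : Set
  Pt = Fin (5 Nat.+ m)

  v₀ v₁ v₂ v₃ v₄ : Pt
  v₀ = # 0
  v₁ = # 1
  v₂ = # 2
  v₃ = # 3
  v₄ = # 4

  v₀<v₁ : v₀ < v₁
  v₀<v₁ = Nat.n<1+n 0
  v₁<v₂ : v₁ < v₂
  v₁<v₂ = Nat.n<1+n 1
  v₂<v₃ : v₂ < v₃
  v₂<v₃ = Nat.n<1+n 2
  v₃<v₄ : v₃ < v₄
  v₃<v₄ = Nat.n<1+n 3
  v₁<v₃ : v₁ < v₃
  v₁<v₃ = Nat.<-trans v₁<v₂ v₂<v₃
  v₀<v₃ : v₀ < v₃
  v₀<v₃ = Nat.<-trans v₀<v₁ v₁<v₃
  v₁<v₄ : v₁ < v₄
  v₁<v₄ = Nat.<-trans v₁<v₃ v₃<v₄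

  _⇒_ : (i j : Pt) → {True (¬? (i ≟ j))} → Arrow (4 Nat.+ m)
  (i ⇒ j) {i≢j} = arrow i j (toWitness i≢j)

  square-HTTH : E (v₁ ⇒ v₀) (v₂ ⇒ v₃) ⊎ E (v₂ ⇒ v₀) (v₁ ⇒ v₃)
  square-HTTH = Sum.map (uncurry separated) (uncurry crossing)
    (square-diagonal at-v₀ at-v₃ at-v₁ at-v₂)
    where
    open SignedFace (v₀ ∷ v₃ ∷ []) (v₁ ∷ v₂ ∷ [])
    L : List (Arrow (4 Nat.+ m))
    L = (v₁ ⇒ v₀) ∷ (v₁ ⇒ v₃) ∷ (v₂ ⇒ v₀) ∷ (v₂ ⇒ v₃) ∷ []
    centre : InConv L (combo L (λ _ → ¼))
    centre = barycentric L ¼ (ℚ.≤ᵇ⇒≤ tt) refl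
    on-top-face : All (λ a → height a ≡ 2ℚ) L
    on-top-face = refl ∷ refl ∷ refl ∷ refl ∷ []
    open TopCover (top-cover tri centre on-top-face)
    at-v₀ : Joins F v₁ v₀ ⊎ Joins F v₂ v₀
    at-v₀ = any₂ (enter v₀ refl (λ ()))
    at-v₃ : Joins F v₁ v₃ ⊎ Joins F v₂ v₃
    at-v₃ = any₂ (enter v₃ refl (λ ()))
    at-v₁ : Joins F v₁ v₀ ⊎ Joins F v₁ v₃
    at-v₁ = any₂ (leave v₁ refl (λ ()))
    at-v₂ : Joins F v₂ v₀ ⊎ Joins F v₂ v₃
    at-v₂ = any₂ (leave v₂ refl (λ ()))
    separated : Joins F v₁ v₀ → Joins F v₂ v₃ → E (v₁ ⇒ v₀) (v₂ ⇒ v₃)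
    separated A D = adjacent sym-E flag A D (λ ())
    crossing : Joins F v₁ v₃ → Joins F v₂ v₀ → E (v₂ ⇒ v₀) (v₁ ⇒ v₃)
    crossing B C = adjacent sym-E flag C B (λ ())

  square-THHT : E (v₀ ⇒ v₁) (v₃ ⇒ v₂) ⊎ E (v₀ ⇒ v₂) (v₃ ⇒ v₁)
  square-THHT = Sum.map (uncurry separated) (uncurry crossing)
    (square-diagonal at-v₁ at-v₂ at-v₀ at-v₃)
    where
    open SignedFace (v₁ ∷ v₂ ∷ []) (v₀ ∷ v₃ ∷ [])
    L : List (Arrow (4 Nat.+ m))
    L = (v₀ ⇒ v₁) ∷ (v₀ ⇒ v₂) ∷ (v₃ ⇒ v₁) ∷ (v₃ ⇒ v₂) ∷ []
    centre : InConv L (combo L (λ _ → ¼))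
    centre = barycentric L ¼ (ℚ.≤ᵇ⇒≤ tt) refl
    on-top-face : All (λ a → height a ≡ 2ℚ) L
    on-top-face = refl ∷ refl ∷ refl ∷ refl ∷ []
    open TopCover (top-cover tri centre on-top-face)
    at-v₁ : Joins F v₀ v₁ ⊎ Joins F v₃ v₁
    at-v₁ = any₂ (enter v₁ refl (λ ()))
    at-v₂ : Joins F v₀ v₂ ⊎ Joins F v₃ v₂
    at-v₂ = any₂ (enter v₂ refl (λ ()))
    at-v₀ : Joins F v₀ v₁ ⊎ Joins F v₀ v₂
    at-v₀ = any₂ (leave v₀ refl (λ ()))
    at-v₃ : Joins F v₃ v₁ ⊎ Joins F v₃ v₂
    at-v₃ = any₂ (leave v₃ refl (λ ()))
    separated : Joins F v₀ v₁ → Joins F v₃ v₂ → E (v₀ ⇒ v₁) (v₃ ⇒ v₂)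
    separated A D = adjacent sym-E flag A D (λ ())
    crossing : Joins F v₀ v₂ → Joins F v₃ v₁ → E (v₀ ⇒ v₂) (v₃ ⇒ v₁)
    crossing B C = adjacent sym-E flag B C (λ ())

  -- The separated pair (v₁→v₀ , v₃→v₄) of type HTTH is not an edge: the prism
  -- with tails v₁, v₃ and heads v₀, v₂, v₄ would have no covering face, since
  -- each choice of square diagonals meets a nesting edge (or the pair itself)
  -- in two segments with a common midpoint.
  separated-HTTH : ¬ E (v₁ ⇒ v₀) (v₃ ⇒ v₄)
  separated-HTTH sep = cyclic-choice at-v₀ at-v₂ at-v₄ at-v₁ at-v₃ forbidden₀₂ forbidden₂₄ forbidden₄₀
    where
    open SignedFace (v₀ ∷ v₂ ∷ v₄ ∷ []) (v₁ ∷ v₃ ∷ [])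
    L : List (Arrow (4 Nat.+ m))
    L = (v₁ ⇒ v₀) ∷ (v₁ ⇒ v₂) ∷ (v₁ ⇒ v₄) ∷ (v₃ ⇒ v₀) ∷ (v₃ ⇒ v₂) ∷ (v₃ ⇒ v₄) ∷ []
    centre : InConv L (combo L (λ _ → ⅙))
    centre = barycentric L ⅙ (ℚ.≤ᵇ⇒≤ tt) refl
    on-top-face : All (λ a → height a ≡ 2ℚ) L
    on-top-face = refl ∷ refl ∷ refl ∷ refl ∷ refl ∷ refl ∷ []
    open TopCover (top-cover tri centre on-top-face)
    at-v₀ : Joins F v₁ v₀ ⊎ Joins F v₃ v₀
    at-v₀ = any₂ (enter v₀ refl (λ ()))
    at-v₂ : Joins F v₁ v₂ ⊎ Joins F v₃ v₂
    at-v₂ = any₂ (enter v₂ refl (λ ()))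
    at-v₄ : Joins F v₁ v₄ ⊎ Joins F v₃ v₄
    at-v₄ = any₂ (enter v₄ refl (λ ()))
    at-v₁ : Joins F v₁ v₀ ⊎ Joins F v₁ v₂ ⊎ Joins F v₁ v₄
    at-v₁ = any₃ (leave v₁ refl (λ ()))
    at-v₃ : Joins F v₃ v₀ ⊎ Joins F v₃ v₂ ⊎ Joins F v₃ v₄
    at-v₃ = any₃ (leave v₃ refl (λ ()))
    forbidden₀₂ : ¬ (Joins F v₁ v₀ × Joins F v₃ v₂)
    forbidden₀₂ (A , B) = no-crossing tri (refl , refl , refl , refl) (λ ()) (λ ())
      (adjacent sym-E flag {v₁ ⇒ v₀} {v₃ ⇒ v₂} A B (λ ()))
      (sym-E _ _ (nest-HTHT v₀<v₁ v₁<v₂ v₂<v₃ v₀<v₃))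
    forbidden₂₄ : ¬ (Joins F v₁ v₂ × Joins F v₃ v₄)
    forbidden₂₄ (A , B) = no-crossing tri (refl , refl , refl , refl) (λ ()) (λ ())
      (adjacent sym-E flag {v₁ ⇒ v₂} {v₃ ⇒ v₄} A B (λ ()))
      (nest-THTH v₁<v₂ v₂<v₃ v₃<v₄ v₁<v₄)
    forbidden₄₀ : ¬ (Joins F v₁ v₄ × Joins F v₃ v₀)
    forbidden₄₀ (A , B) = no-crossing tri (refl , refl , refl , refl) (λ ()) (λ ())
      (adjacent sym-E flag {v₁ ⇒ v₄} {v₃ ⇒ v₀} A B (λ ())) sep

  -- Dually, the separated pair (v₀→v₁ , v₄→v₃) of type THHT is not an edge,
  -- by the prism with tails v₀, v₂, v₄ and heads v₁, v₃.
  separated-THHT : ¬ E (v₀ ⇒ v₁) (v₄ ⇒ v₃)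
  separated-THHT sep = cyclic-choice at-v₀ at-v₂ at-v₄ at-v₁ at-v₃ forbidden₀₂ forbidden₂₄ forbidden₄₀
    where
    open SignedFace (v₁ ∷ v₃ ∷ []) (v₀ ∷ v₂ ∷ v₄ ∷ [])
    L : List (Arrow (4 Nat.+ m))
    L = (v₀ ⇒ v₁) ∷ (v₂ ⇒ v₁) ∷ (v₄ ⇒ v₁) ∷ (v₀ ⇒ v₃) ∷ (v₂ ⇒ v₃) ∷ (v₄ ⇒ v₃) ∷ []
    centre : InConv L (combo L (λ _ → ⅙))
    centre = barycentric L ⅙ (ℚ.≤ᵇ⇒≤ tt) refl
    on-top-face : All (λ a → height a ≡ 2ℚ) L
    on-top-face = refl ∷ refl ∷ refl ∷ refl ∷ refl ∷ refl ∷ []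
    open TopCover (top-cover tri centre on-top-face)
    at-v₀ : Joins F v₀ v₁ ⊎ Joins F v₀ v₃
    at-v₀ = any₂ (leave v₀ refl (λ ()))
    at-v₂ : Joins F v₂ v₁ ⊎ Joins F v₂ v₃
    at-v₂ = any₂ (leave v₂ refl (λ ()))
    at-v₄ : Joins F v₄ v₁ ⊎ Joins F v₄ v₃
    at-v₄ = any₂ (leave v₄ refl (λ ()))
    at-v₁ : Joins F v₀ v₁ ⊎ Joins F v₂ v₁ ⊎ Joins F v₄ v₁
    at-v₁ = any₃ (enter v₁ refl (λ ()))
    at-v₃ : Joins F v₀ v₃ ⊎ Joins F v₂ v₃ ⊎ Joins F v₄ v₃
    at-v₃ = any₃ (enter v₃ refl (λ ()))
    forbidden₀₂ : ¬ (Joins F v₀ v₁ × Joins F v₂ v₃)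
    forbidden₀₂ (A , B) = no-crossing tri (refl , refl , refl , refl) (λ ()) (λ ())
      (adjacent sym-E flag {v₀ ⇒ v₁} {v₂ ⇒ v₃} A B (λ ()))
      (nest-THTH v₀<v₁ v₁<v₂ v₂<v₃ v₀<v₃)
    forbidden₂₄ : ¬ (Joins F v₂ v₁ × Joins F v₄ v₃)
    forbidden₂₄ (A , B) = no-crossing tri (refl , refl , refl , refl) (λ ()) (λ ())
      (adjacent sym-E flag {v₂ ⇒ v₁} {v₄ ⇒ v₃} A B (λ ()))
      (sym-E _ _ (nest-HTHT v₁<v₂ v₂<v₃ v₃<v₄ v₁<v₄))
    forbidden₄₀ : ¬ (Joins F v₄ v₁ × Joins F v₀ v₃)
    forbidden₄₀ (A , B) = no-crossing tri (refl , refl , refl , refl) (λ ()) (λ ())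
      (adjacent sym-E flag {v₄ ⇒ v₁} {v₀ ⇒ v₃} A B (λ ())) (sym-E _ _ sep)

  increasing-v₀₁₂₃ : Increasing (lookup (v₀ ∷ v₁ ∷ v₂ ∷ v₃ ∷ []))
  increasing-v₀₁₂₃ = chain-increasing (v₀<v₁ ∷ v₁<v₂ ∷ v₂<v₃ ∷ [-])

  increasing-v₀₁₃₄ : Increasing (lookup (v₀ ∷ v₁ ∷ v₃ ∷ v₄ ∷ []))
  increasing-v₀₁₃₄ = chain-increasing (v₀<v₁ ∷ v₁<v₃ ∷ v₃<v₄ ∷ [-])

  -- The separated diagonals of the squares have the order types of the
  -- excluded separated pairs, so by uniformity they are not edges and the
  -- squares are split by their crossing diagonals.
  crossing-HTTH : E (v₂ ⇒ v₀) (v₁ ⇒ v₃)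
  crossing-HTTH = forced′ square-HTTH (separated-HTTH ∘ relabel)
    where
    relabel : E (v₁ ⇒ v₀) (v₂ ⇒ v₃) → E (v₁ ⇒ v₀) (v₃ ⇒ v₄)
    relabel = uniform-transfer uni increasing-v₀₁₂₃ increasing-v₀₁₃₄ (lookup (1F ∷ 0F ∷ 2F ∷ 3F ∷ []))
      (quad-≗ refl refl refl refl) (quad-≗ refl refl refl refl) (λ ())

  crossing-THHT : E (v₀ ⇒ v₂) (v₃ ⇒ v₁)
  crossing-THHT = forced′ square-THHT (separated-THHT ∘ relabel)
    where
    relabel : E (v₀ ⇒ v₁) (v₃ ⇒ v₂) → E (v₀ ⇒ v₁) (v₄ ⇒ v₃)
    relabel = uniform-transfer uni increasing-v₀₁₂₃ increasing-v₀₁₃₄ (lookup (0F ∷ 1F ∷ 3F ∷ 2F ∷ []))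
      (quad-≗ refl refl refl refl) (quad-≗ refl refl refl refl) (λ ())

  crosses-HTTH : CrossesHTTH E
  crosses-HTTH h₁₂ h₂₃ h₃₄ _ _ =
    uniform-transfer uni increasing-v₀₁₂₃ (chain-increasing (h₁₂ ∷ h₂₃ ∷ h₃₄ ∷ [-]))
      (lookup (2F ∷ 0F ∷ 1F ∷ 3F ∷ [])) (quad-≗ refl refl refl refl) (quad-≗ refl refl refl refl)
      (λ ()) crossing-HTTH

  crosses-THHT : CrossesTHHT E
  crosses-THHT h₁₂ h₂₃ h₃₄ _ _ =
    uniform-transfer uni increasing-v₀₁₂₃ (chain-increasing (h₁₂ ∷ h₂₃ ∷ h₃₄ ∷ [-]))
      (lookup (0F ∷ 2F ∷ 3F ∷ 1F ∷ [])) (quad-≗ refl refl refl refl) (quad-≗ refl refl refl refl)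
      (λ ()) crossing-THHT

proposition3p6 : (n : ℕ) → 4 ≤ n → (E : Arrow n → Arrow n → Set) →
    Symmetric E → Uniform E →
    RepresentsTriangulation n (FlagFace E) →
    NestsTHTH E → NestsHTHT E →
    CrossesHTTH E × CrossesTHHT E
proposition3p6 .(4 Nat.+ m) (s≤s (s≤s (s≤s (s≤s {n = m} z≤n)))) E sym-E uni tri nest-THTH nest-HTHT =
  crosses-HTTH , crosses-THHT
  where open FivePoints m sym-E uni tri nest-THTH nest-HTHT
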